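{- Let $\Sigma$ be a finite connected simple graph and $f$ an integer-valued function on its vertices. Then there exists a finite connected simple graph $\Gamma$ containing $\Sigma$ as a motif (i.e. as a connected subgraph containing all edges of $\Gamma$ between vertices of $\Sigma$) such that $1$ is an eigenvalue of the normalized Laplacian of $\Gamma$ with an eigenfunction coinciding with $f$ on the vertices of $\Sigma$.
   Context: For a finite graph without isolated vertices, with degrees $n_i$, the normalized Laplacian is $\Delta v(i)=v(i)-\frac{1}{n_i}\sum_{j\sim i}v(j)$ on real functions on the vertices; an eigenfunction for $\lambda$ is a nonzero $u$ with $\Delta u=\lambda u$. A nonzero $u$ is an eigenfunction for the eigenvalue $1$ iff $\sum_{j\sim i}u(j)=0$ for every vertex $i$. -}

module Defs where

open import Data.Nat using (ℕ; zero; suc)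
open import Data.Bool using (Bool; true; false; if_then_else_)
open import Data.Fin using (Fin)
open import Data.Integer using (ℤ; +_)
open import Data.Rational using (ℚ; 0ℚ; _+_; _-_; _*_; _/_)
open import Data.List using (List; []; _∷_; foldr; filter; length)
open import Data.List using (allFin)
open import Data.Product using (Σ; ∃; ∃-syntax; _×_; _,_)
open import Data.Empty using (⊥)
open import Function.Definitions using (Injective)
open import Relation.Binary.PropositionalEquality using (_≡_)
open import Relation.Nullary using (¬_)
open import Relation.Nullary.Decidable using (does)
open import Data.Bool using (T)

record Graph (n : ℕ) : Set where
  field
    adj   : Fin n → Fin n → Bool
    sym   : ∀ i j → adj i j ≡ adj j i
    irref : ∀ i → adj i i ≡ false
open Graph public

data Walk {n : ℕ} (G : Graph n) : Fin n → Fin n → Set where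
  here : ∀ {i} → Walk G i i
  step : ∀ {i j k} → adj G i j ≡ true → Walk G j k → Walk G i k

Connected : ∀ {n} → Graph n → Set
Connected {n} G = (i j : Fin n) → Walk G i j

neighbours : ∀ {n} → Graph n → Fin n → List (Fin n)
neighbours {n} G i = Data.List.filter (λ j → Data.Bool._≟_ (adj G i j) true) (allFin n)

degree : ∀ {n} → Graph n → Fin n → ℕ
degree G i = length (neighbours G i)

NoIsolated : ∀ {n} → Graph n → Set
NoIsolated {n} G = (i : Fin n) → ¬ (degree G i ≡ 0)

neighbourSum : ∀ {n} → Graph n → (Fin n → ℚ) → Fin n → ℚ
neighbourSum G v i = foldr (λ j acc → v j + acc) 0ℚ (neighbours G i)

-- (1/d) * x ; for d = 0 (isolated vertex, excluded where used) it returns 0.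
scaleInv : ℕ → ℚ → ℚ
scaleInv zero    x = 0ℚ
scaleInv (suc k) x = ((+ 1) / suc k) * x

Δ : ∀ {n} → Graph n → (Fin n → ℚ) → Fin n → ℚ
Δ G v i = v i - scaleInv (degree G i) (neighbourSum G v i)

IsEigenfunction : ∀ {n} → Graph n → ℚ → (Fin n → ℚ) → Set
IsEigenfunction {n} G λ' u = (¬ (∀ i → u i ≡ 0ℚ)) × (∀ i → Δ G u i ≡ λ' * u i)

IsMotifVia : ∀ {n m} → Graph n → Graph m → (Fin n → Fin m) → Set
IsMotifVia {n} S G φ =
  Injective _≡_ _≡_ φ × Connected S × (∀ i j → adj S i j ≡ adj G (φ i) (φ j))

-- Let Γ consist of two copies of Σ, each vertex joined to both copies of each of its
-- Σ-neighbours, two hubs joined to every copy, and a bridge joined to the two hubs (so that Γ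
-- is connected without isolated vertices even when Σ is empty). Put f and −f on the two copies,
-- 1 and −1 on the hubs and 0 on the bridge. The involution exchanging the two copies of each
-- vertex and the two hubs preserves every neighbourhood and negates u, so every neighbour sum
-- of u is its own negative, hence 0.
module Submission where

open import Defs
open import Algebra.Properties.CommutativeMonoid.Sum as Sum using ()
open import Data.Bool using (Bool; true; false; if_then_else_)
import Data.Bool as Bool
open import Data.Fin using (Fin; zero; suc; splitAt; join; _↑ˡ_)
open import Data.Fin.Permutation using (Permutation′; permutation; _⟨$⟩ʳ_)
open import Data.Fin.Properties using (splitAt-↑ˡ; splitAt-join; join-splitAt; ↑ˡ-injective; suc-injective)
open import Data.Integer as ℤ using (ℤ)
open import Data.List using (List; []; _∷_; foldr; filter; tabulate; length)
open import Data.List.Membership.Propositional using (_∈_)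
open import Data.List.Membership.Propositional.Properties using (∈-filter⁺; ∈-allFin)
open import Data.List.Relation.Unary.Any using (here; there)
open import Data.Nat using (ℕ; zero; suc) renaming (_+_ to _+ℕ_)
open import Data.Product using (Σ; ∃-syntax; _×_; _,_)
open import Data.Rational using (ℚ; 0ℚ; 1ℚ; ½; _/_; _+_; _*_; _-_; -_)
open import Data.Rational.Properties
  using (+-0-commutativeMonoid; +-identityˡ; +-identityʳ; *-identityˡ; *-zeroʳ; *-distribˡ-+; *-distribʳ-+; +-inverseˡ; +-inverseʳ)
open import Data.Sum using (_⊎_; inj₁; inj₂; [_,_]′; reduce; swap)
open import Data.Sum.Properties using (swap-involutive)
open import Function.Definitions using (Injective)
open import Relation.Binary.PropositionalEquality
  using (_≡_; _≢_; refl; cong; cong₂; trans; module ≡-Reasoning)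
  renaming (sym to ≡-sym)
open import Relation.Nullary using (¬_)

open Sum +-0-commutativeMonoid using (sum; ∑-distrib-+; ∑-permute; sum-cong-≗; sum-replicate-zero)
open ≡-Reasoning

x+x≡0⇒x≡0 : ∀ x → x + x ≡ 0ℚ → x ≡ 0ℚ
x+x≡0⇒x≡0 x x+x≡0 = begin
  x                 ≡⟨ *-identityˡ x ⟨
  (½ + ½) * x       ≡⟨ *-distribʳ-+ x ½ ½ ⟩
  ½ * x + ½ * x     ≡⟨ *-distribˡ-+ ½ x x ⟨
  ½ * (x + x)       ≡⟨ cong (½ *_) x+x≡0 ⟩
  ½ * 0ℚ            ≡⟨ *-zeroʳ ½ ⟩
  0ℚ                ∎

sum-odd≡0 : ∀ {m} (σ : Permutation′ m) (w : Fin m → ℚ) →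
            (∀ j → w j + w (σ ⟨$⟩ʳ j) ≡ 0ℚ) → sum w ≡ 0ℚ
sum-odd≡0 {m} σ w odd = x+x≡0⇒x≡0 (sum w) (begin
  sum w + sum w                          ≡⟨ cong (sum w +_) (∑-permute w σ) ⟩
  sum w + sum (λ j → w (σ ⟨$⟩ʳ j))       ≡⟨ ∑-distrib-+ w _ ⟨
  sum (λ j → w j + w (σ ⟨$⟩ʳ j))         ≡⟨ sum-cong-≗ odd ⟩
  sum {m} (λ _ → 0ℚ)                     ≡⟨ sum-replicate-zero m ⟩
  0ℚ                                     ∎)

module _ {m : ℕ} (G : Graph m) where

  foldr-filter : (i : Fin m) (v : Fin m → ℚ) (js : List (Fin m)) →
    foldr (λ j acc → v j + acc) 0ℚ (filter (λ j → adj G i j Bool.≟ true) js)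
      ≡ foldr (λ j acc → (if adj G i j then v j else 0ℚ) + acc) 0ℚ js
  foldr-filter i v [] = refl
  foldr-filter i v (j ∷ js) with adj G i j
  ... | true  = cong (v j +_) (foldr-filter i v js)
  ... | false = trans (foldr-filter i v js) (≡-sym (+-identityˡ _))

  foldr-tabulate : ∀ {k} (w : Fin m → ℚ) (h : Fin k → Fin m) →
    foldr (λ j acc → w j + acc) 0ℚ (tabulate h) ≡ sum (λ j → w (h j))
  foldr-tabulate {zero}  w h = refl
  foldr-tabulate {suc k} w h = cong (w (h zero) +_) (foldr-tabulate w (λ j → h (suc j)))

  neighbourSum≡sum : ∀ v i → neighbourSum G v i ≡ sum (λ j → if adj G i j then v j else 0ℚ)
  neighbourSum≡sum v i = trans (foldr-filter i v (tabulate (λ j → j))) (foldr-tabulate _ (λ j → j))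

  neighbourSum≡0 : (σ : Permutation′ m) → (∀ i j → adj G i (σ ⟨$⟩ʳ j) ≡ adj G i j) →
                   ∀ v → (∀ j → v j + v (σ ⟨$⟩ʳ j) ≡ 0ℚ) → ∀ i → neighbourSum G v i ≡ 0ℚ
  neighbourSum≡0 σ σ-preserves-adj v v-odd i =
    trans (neighbourSum≡sum v i) (sum-odd≡0 σ _ masked-odd)
    where
    masked-odd : ∀ j → (if adj G i j then v j else 0ℚ)
                         + (if adj G i (σ ⟨$⟩ʳ j) then v (σ ⟨$⟩ʳ j) else 0ℚ) ≡ 0ℚ
    masked-odd j rewrite σ-preserves-adj i j with adj G i j
    ... | true  = v-odd j
    ... | false = refl

  scaleInv-0 : ∀ d → scaleInv d 0ℚ ≡ 0ℚ
  scaleInv-0 zero    = refl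
  scaleInv-0 (suc d) = *-zeroʳ (ℤ.+ 1 / suc d)

  isEigenfunction-1 : ∀ v → ¬ (∀ i → v i ≡ 0ℚ) → (∀ i → neighbourSum G v i ≡ 0ℚ) →
                      IsEigenfunction G 1ℚ v
  isEigenfunction-1 v v≢0 balanced = v≢0 , λ i → begin
    v i - scaleInv (degree G i) (neighbourSum G v i) ≡⟨ cong (λ s → v i - scaleInv (degree G i) s) (balanced i) ⟩
    v i - scaleInv (degree G i) 0ℚ                   ≡⟨ cong (λ s → v i - s) (scaleInv-0 (degree G i)) ⟩
    v i - 0ℚ                                         ≡⟨ +-identityʳ (v i) ⟩
    v i                                              ≡⟨ *-identityˡ (v i) ⟨
    1ℚ * v i                                         ∎

  degree≢0 : ∀ i j → adj G i j ≡ true → degree G i ≢ 0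
  degree≢0 i j i~j = nonempty (∈-filter⁺ (λ k → adj G i k Bool.≟ true) (∈-allFin j) i~j)
    where
    nonempty : ∀ {ks : List (Fin m)} → j ∈ ks → length ks ≢ 0
    nonempty (here _)  ()
    nonempty (there _) ()

  walk-++ : ∀ {i j k} → Walk G i j → Walk G j k → Walk G i k
  walk-++ here         q = q
  walk-++ (step i~j p) q = step i~j (walk-++ p q)

  walk-reverse : ∀ {i j} → Walk G i j → Walk G j i
  walk-reverse here                 = here
  walk-reverse (step {i} {j} i~j p) = walk-++ (walk-reverse p) (step (trans (Graph.sym G j i) i~j) here)

  connected-if-reach : (c : Fin m) → (∀ i → Walk G i c) → Connected G
  connected-if-reach c reach i j = walk-++ (reach i) (walk-reverse (reach j))

module Construction {n : ℕ} (S : Graph n) (f : Fin n → ℤ) where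

  data Kind : Set where
    hub bridge : Kind
    copyOf     : Fin n → Kind

  link : Kind → Kind → Bool
  link hub        hub        = false
  link hub        bridge     = true
  link hub        (copyOf _) = true
  link bridge     hub        = true
  link bridge     bridge     = false
  link bridge     (copyOf _) = false
  link (copyOf _) hub        = true
  link (copyOf _) bridge     = false
  link (copyOf i) (copyOf j) = adj S i j

  link-sym : ∀ a b → link a b ≡ link b a
  link-sym hub        hub        = refl
  link-sym hub        bridge     = refl
  link-sym hub        (copyOf _) = refl
  link-sym bridge     hub        = refl
  link-sym bridge     bridge     = refl
  link-sym bridge     (copyOf _) = refl
  link-sym (copyOf _) hub        = refl
  link-sym (copyOf _) bridge     = refl
  link-sym (copyOf i) (copyOf j) = Graph.sym S i j

  link-irrefl : ∀ a → link a a ≡ false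
  link-irrefl hub        = refl
  link-irrefl bridge     = refl
  link-irrefl (copyOf i) = irref S i

  V : ℕ
  V = 3 +ℕ (n +ℕ n)

  -- Vertices 0 and 1 are the hubs, 2 is the bridge, and 3 + (i ↑ˡ n), 3 + (n ↑ʳ i)
  -- are the two copies of the vertex i of S.
  kind : Fin V → Kind
  kind zero                   = hub
  kind (suc zero)             = hub
  kind (suc (suc zero))       = bridge
  kind (suc (suc (suc k)))    = copyOf (reduce (splitAt n k))

  Γ : Graph V
  Γ = record
    { adj   = λ x y → link (kind x) (kind y)
    ; sym   = λ x y → link-sym (kind x) (kind y)
    ; irref = λ x → link-irrefl (kind x)
    }

  twin : Fin (n +ℕ n) → Fin (n +ℕ n)
  twin k = join n n (swap (splitAt n k))

  splitAt-twin : ∀ k → splitAt n (twin k) ≡ swap (splitAt n k)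
  splitAt-twin k = splitAt-join n n (swap (splitAt n k))

  twin-involutive : ∀ k → twin (twin k) ≡ k
  twin-involutive k = begin
    join n n (swap (splitAt n (twin k)))  ≡⟨ cong (λ s → join n n (swap s)) (splitAt-twin k) ⟩
    join n n (swap (swap (splitAt n k)))  ≡⟨ cong (join n n) (swap-involutive (splitAt n k)) ⟩
    join n n (splitAt n k)                ≡⟨ join-splitAt n n k ⟩
    k                                     ∎

  swapTwins : Fin V → Fin V
  swapTwins zero                = suc zero
  swapTwins (suc zero)          = zero
  swapTwins (suc (suc zero))    = suc (suc zero)
  swapTwins (suc (suc (suc k))) = suc (suc (suc (twin k)))

  swapTwins-involutive : ∀ x → swapTwins (swapTwins x) ≡ x
  swapTwins-involutive zero                = refl
  swapTwins-involutive (suc zero)          = refl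
  swapTwins-involutive (suc (suc zero))    = refl
  swapTwins-involutive (suc (suc (suc k))) = cong (λ k → suc (suc (suc k))) (twin-involutive k)

  σ : Permutation′ V
  σ = permutation swapTwins swapTwins swapTwins-involutive swapTwins-involutive

  kind-swapTwins : ∀ x → kind (swapTwins x) ≡ kind x
  kind-swapTwins zero                = refl
  kind-swapTwins (suc zero)          = refl
  kind-swapTwins (suc (suc zero))    = refl
  kind-swapTwins (suc (suc (suc k))) =
    cong copyOf (trans (cong reduce (splitAt-twin k)) (reduce-swap (splitAt n k)))
    where
    reduce-swap : ∀ (s : Fin n ⊎ Fin n) → reduce (swap s) ≡ reduce s
    reduce-swap (inj₁ _) = refl
    reduce-swap (inj₂ _) = refl

  adj-swapTwins : ∀ x y → adj Γ x (σ ⟨$⟩ʳ y) ≡ adj Γ x y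
  adj-swapTwins x y = cong (link (kind x)) (kind-swapTwins y)

  signed : Fin n ⊎ Fin n → ℚ
  signed = [ (λ i → f i / 1) , (λ i → - (f i / 1)) ]′

  signed-swap : ∀ s → signed s + signed (swap s) ≡ 0ℚ
  signed-swap (inj₁ i) = +-inverseʳ (f i / 1)
  signed-swap (inj₂ i) = +-inverseˡ (f i / 1)

  u : Fin V → ℚ
  u zero                = 1ℚ
  u (suc zero)          = - 1ℚ
  u (suc (suc zero))    = 0ℚ
  u (suc (suc (suc k))) = signed (splitAt n k)

  u-odd : ∀ x → u x + u (σ ⟨$⟩ʳ x) ≡ 0ℚ
  u-odd zero                = refl
  u-odd (suc zero)          = refl
  u-odd (suc (suc zero))    = refl
  u-odd (suc (suc (suc k))) rewrite splitAt-twin k = signed-swap (splitAt n k)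

  u≢0 : ¬ (∀ x → u x ≡ 0ℚ)
  u≢0 u≡0 with u≡0 zero
  ... | ()

  reach-hub : ∀ x → Walk Γ x zero
  reach-hub zero                = here
  reach-hub (suc zero)          = step {j = suc (suc zero)} refl (step refl here)
  reach-hub (suc (suc zero))    = step refl here
  reach-hub (suc (suc (suc k))) = step refl here

  noIsolated : NoIsolated Γ
  noIsolated zero                = degree≢0 Γ zero                (suc (suc zero)) refl
  noIsolated (suc zero)          = degree≢0 Γ (suc zero)          (suc (suc zero)) refl
  noIsolated (suc (suc zero))    = degree≢0 Γ (suc (suc zero))    zero             refl
  noIsolated (suc (suc (suc k))) = degree≢0 Γ (suc (suc (suc k))) zero             refl

  embed : Fin n → Fin V
  embed i = suc (suc (suc (i ↑ˡ n)))

  embed-injective : Injective _≡_ _≡_ embed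
  embed-injective {i} {j} eq = ↑ˡ-injective n i j (suc-injective (suc-injective (suc-injective eq)))

  kind-embed : ∀ i → kind (embed i) ≡ copyOf i
  kind-embed i = cong (λ s → copyOf (reduce s)) (splitAt-↑ˡ n i n)

  u-embed : ∀ i → u (embed i) ≡ f i / 1
  u-embed i = cong signed (splitAt-↑ˡ n i n)

  isMotif : Connected S → IsMotifVia S Γ embed
  isMotif S-connected = embed-injective , S-connected ,
    λ i j → ≡-sym (cong₂ link (kind-embed i) (kind-embed j))

open Construction

mainTheorem8 : (n : ℕ) (S : Graph n) → Connected S → (f : Fin n → ℤ) →
    ∃[ m ] Σ (Graph m) λ Γ → Σ (Fin n → Fin m) λ φ → Σ (Fin m → ℚ) λ u →
    Connected Γ × NoIsolated Γ × IsMotifVia S Γ φ ×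
    IsEigenfunction Γ 1ℚ u × (∀ i → u (φ i) ≡ (f i / 1))
mainTheorem8 n S S-connected f =
  V S f , Γ S f , embed S f , u S f ,
  connected-if-reach (Γ S f) zero (reach-hub S f) ,
  noIsolated S f ,
  isMotif S f S-connected ,
  isEigenfunction-1 (Γ S f) (u S f) (u≢0 S f)
    (neighbourSum≡0 (Γ S f) (σ S f) (adj-swapTwins S f) (u S f) (u-odd S f)) ,
  u-embed S f
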